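{- For each $n\ge 1$, all pairwise-summation SD-trees with $n$ leaf nodes are isomorphic to one another, and therefore all have the same number of $S$-nodes.
   Context: A summation tree is a rooted full binary tree (every node has $0$ or $2$ children). Two summation trees are isomorphic if one can be obtained from the other by a finite sequence of swaps of the two children (with their subtrees) of internal nodes. An SD-tree is a summation tree in which each internal node is labelled $S$ ($S$-node) if its two children have the same number of descendant leaves, and $D$ otherwise. A pairwise-summation tree is a summation tree in which every internal node having $k$ descendant leaves has two children having $\lfloor k/2\rfloor$ and $\lceil k/2\rceil$ descendant leaves respectively. -}

module Defs where

open import Data.Nat using (ℕ; zero; suc; _+_; _/_; _∸_)
open import Relation.Binary.PropositionalEquality using (_≡_)
open import Relation.Binary.Construct.Closure.ReflexiveTransitive using (Star)
open import Data.Product using (_×_)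
open import Data.Sum using (_⊎_)
open import Data.Bool using (if_then_else_)
open import Data.Nat using (_≡ᵇ_)

data Tree : Set where
  leaf : Tree
  node : Tree → Tree → Tree

leaves : Tree → ℕ
leaves leaf = 1
leaves (node l r) = leaves l + leaves r

data Swap : Tree → Tree → Set where
  here  : ∀ l r → Swap (node l r) (node r l)
  left  : ∀ {l l′} r → Swap l l′ → Swap (node l r) (node l′ r)
  right : ∀ l {r r′} → Swap r r′ → Swap (node l r) (node l r′)

-- Isomorphism: obtainable by a finite sequence of swaps.
_≅_ : Tree → Tree → Set
_≅_ = Star Swap

data Pairwise : Tree → Set where
  leaf : Pairwise leaf
  node : ∀ {l r} → Pairwise l → Pairwise r →
         (leaves l ≡ (leaves l + leaves r) / 2 × leaves r ≡ (leaves l + leaves r) ∸ (leaves l + leaves r) / 2)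
         ⊎ (leaves r ≡ (leaves l + leaves r) / 2 × leaves l ≡ (leaves l + leaves r) ∸ (leaves l + leaves r) / 2) →
         Pairwise (node l r)

-- SD-labelling: an internal node is an S-node iff its two children have the
-- same number of descendant leaves (D otherwise). Number of S-nodes:
sNodes : Tree → ℕ
sNodes leaf = 0
sNodes (node l r) =
  (if leaves l ≡ᵇ leaves r then 1 else 0) + sNodes l + sNodes r

-- A pairwise-summation tree with k leaves has children with ⌊k/2⌋ and ⌈k/2⌉
-- leaves, so the leaf counts of the children of two such trees of equal size
-- agree up to order. Matching children accordingly, an induction on the tree
-- produces a sequence of swaps between any two of them; swaps preserve the
-- number of S-nodes since the S/D label of a node is symmetric in its children.
module Submission where

open import Defs
open import Data.Nat using (ℕ; _≥_; zero; suc; _+_; _/_; _∸_; _≡ᵇ_; _≤_; _<_; s≤s; z≤n)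
open import Data.Nat.Properties using (+-comm; ≤-trans; m≤m+n; +-mono-≤; >⇒≢; +-commutativeSemigroup)
open import Algebra.Properties.CommutativeSemigroup +-commutativeSemigroup using (xy∙z≈xz∙y)
open import Data.Product using (_×_; _,_)
open import Data.Sum using (_⊎_; inj₁; inj₂)
open import Data.Empty using (⊥-elim)
open import Relation.Binary.PropositionalEquality using (_≡_; refl; sym; trans; cong)
open import Relation.Binary.Construct.Closure.ReflexiveTransitive using (ε; _◅_; _◅◅_; gmap)

1≤leaves : ∀ t → 1 ≤ leaves t
1≤leaves leaf       = s≤s z≤n
1≤leaves (node l r) = ≤-trans (1≤leaves l) (m≤m+n _ _)

1<leaves-node : ∀ l r → 1 < leaves (node l r)
1<leaves-node l r = +-mono-≤ (1≤leaves l) (1≤leaves r)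

≅-node : ∀ {l l′ r r′} → l ≅ l′ → r ≅ r′ → node l r ≅ node l′ r′
≅-node {l′ = l′} {r = r} l≅l′ r≅r′ =
  gmap (λ x → node x r) (left r) l≅l′ ◅◅ gmap (node l′) (right l′) r≅r′

≅-swap : ∀ l r → node l r ≅ node r l
≅-swap l r = here l r ◅ ε

Halves : ℕ → ℕ → ℕ → Set
Halves k a b = a ≡ k / 2 × b ≡ k ∸ k / 2

halves-unique : ∀ {k k′ a b a′ b′} → k ≡ k′ →
                Halves k a b → Halves k′ a′ b′ → a ≡ a′ × b ≡ b′
halves-unique refl (a≡ , b≡) (a′≡ , b′≡) = trans a≡ (sym a′≡) , trans b≡ (sym b′≡)

halves-match : ∀ {k k′ a b a′ b′} → k ≡ k′ →
               Halves k a b ⊎ Halves k b a → Halves k′ a′ b′ ⊎ Halves k′ b′ a′ →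
               (a ≡ a′ × b ≡ b′) ⊎ (a ≡ b′ × b ≡ a′)
halves-match e (inj₁ h) (inj₁ h′) = inj₁ (halves-unique e h h′)
halves-match e (inj₂ h) (inj₂ h′) with halves-unique e h h′
... | b≡b′ , a≡a′ = inj₁ (a≡a′ , b≡b′)
halves-match e (inj₁ h) (inj₂ h′) = inj₂ (halves-unique e h h′)
halves-match e (inj₂ h) (inj₁ h′) with halves-unique e h h′
... | b≡a′ , a≡b′ = inj₂ (a≡b′ , b≡a′)

pairwise-≅ : ∀ {t u} → Pairwise t → Pairwise u → leaves t ≡ leaves u → t ≅ u
pairwise-≅ leaf leaf _ = ε
pairwise-≅ leaf (node {l} {r} _ _ _) e = ⊥-elim (>⇒≢ (1<leaves-node l r) (sym e))
pairwise-≅ (node {l} {r} _ _ _) leaf e = ⊥-elim (>⇒≢ (1<leaves-node l r) e)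
pairwise-≅ (node {l} {r} pl pr h) (node {l′} {r′} pl′ pr′ h′) e
  with halves-match e h h′
... | inj₁ (l≡l′ , r≡r′) = ≅-node (pairwise-≅ pl pl′ l≡l′) (pairwise-≅ pr pr′ r≡r′)
... | inj₂ (l≡r′ , r≡l′) =
  ≅-node (pairwise-≅ pl pr′ l≡r′) (pairwise-≅ pr pl′ r≡l′) ◅◅ ≅-swap r′ l′

≡ᵇ-sym : ∀ m n → (m ≡ᵇ n) ≡ (n ≡ᵇ m)
≡ᵇ-sym zero    zero    = refl
≡ᵇ-sym zero    (suc n) = refl
≡ᵇ-sym (suc m) zero    = refl
≡ᵇ-sym (suc m) (suc n) = ≡ᵇ-sym m n

Swap⇒leaves-≡ : ∀ {t u} → Swap t u → leaves t ≡ leaves u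
Swap⇒leaves-≡ (here l r)  = +-comm (leaves l) (leaves r)
Swap⇒leaves-≡ (left r s)  = cong (_+ leaves r) (Swap⇒leaves-≡ s)
Swap⇒leaves-≡ (right l s) = cong (leaves l +_) (Swap⇒leaves-≡ s)

Swap⇒sNodes-≡ : ∀ {t u} → Swap t u → sNodes t ≡ sNodes u
Swap⇒sNodes-≡ (here l r) rewrite ≡ᵇ-sym (leaves l) (leaves r) =
  xy∙z≈xz∙y _ (sNodes l) (sNodes r)
Swap⇒sNodes-≡ (left r s)  rewrite Swap⇒leaves-≡ s | Swap⇒sNodes-≡ s = refl
Swap⇒sNodes-≡ (right l s) rewrite Swap⇒leaves-≡ s | Swap⇒sNodes-≡ s = refl

≅⇒sNodes-≡ : ∀ {t u} → t ≅ u → sNodes t ≡ sNodes u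
≅⇒sNodes-≡ ε        = refl
≅⇒sNodes-≡ (s ◅ ss) = trans (Swap⇒sNodes-≡ s) (≅⇒sNodes-≡ ss)

lemma10 : (n : ℕ) → n ≥ 1 → (t u : Tree) →
          Pairwise t → Pairwise u → leaves t ≡ n → leaves u ≡ n →
          (t ≅ u) × (sNodes t ≡ sNodes u)
lemma10 n _ t u pt pu t≡n u≡n = t≅u , ≅⇒sNodes-≡ t≅u
  where
  t≅u : t ≅ u
  t≅u = pairwise-≅ pt pu (trans t≡n (sym u≡n))
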